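{- Let $\varepsilon>0$, let $H:\{0,1\}^s\to\{0,1\}^n$ be an $\varepsilon$-hitting set generator for ordered branching programs of length $n$ and width $w^2$, and let $B$ be an ordered branching program of width $w$ and length $n$. Let $T:\{0,1\}^n\to\{0,1\}$ be the indicator of the event that the path in $B$ from the start state on input $z$ passes through an unverified state. Then $\Pr_{z\in\{0,1\}^n\text{ uniform}}[T(z)=1]<2\varepsilon$.
   Context: An ordered branching program (OBP) of length $n$ and width $w$ has layers $V_0,\ldots,V_n$ with $|V_i|\le w$, a single start state $v_0\in V_0$, two outgoing edges labeled $0$ and $1$ from each state of $V_i$ ($i<n$) into $V_{i+1}$, and labels in $\{0,1\}$ on $V_n$; $B[v,\sigma]$ is the state reached from $v$ following the edges labeled by $\sigma$. An $\varepsilon$-hitting set generator $H$ for a class $\mathcal{F}$ of functions $\{0,1\}^n\to\{0,1\}$ satisfies: every $f\in\mathcal{F}$ with $\Pr_{x\text{ uniform}}[f(x)=1]\ge\varepsilon$ has $f(H(y))=1$ for some $y$. Define $v_i(x)=B[v_0,H(x)_{1..i}]$. For $x\in\{0,1\}^s$ and $i<n$, the state $v=v_i(x)$ is unverified if there is some $b\in\{0,1\}$ such that no $x'\in\{0,1\}^s$ satisfies $B[v,b]=v_{i+1}(x')$; otherwise it is verified; every state $v_n(x)$ is verified. (States not of the form $v_i(x)$ are neither.)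
   Formalization: The parameter ε ranges over the positive rationals. -}

module Defs where

import Level
open import Data.Bool using (Bool; true; false)
open import Data.Nat using (ℕ; zero; suc; _^_; _≤_; _<_)
open import Data.Nat.Properties using (<⇒≤; ≤-refl; m^n≢0)
open import Data.Fin using (Fin; toℕ; fromℕ<; inject₁)
open import Data.Fin.Properties using (toℕ≤pred[n])
open import Data.Vec using (Vec; []; _∷_; lookup)
open import Data.List using (List; _∷_; []; map; _++_; filter; length)
open import Data.Integer using (+_)
open import Data.Rational using (ℚ; _/_)
open import Data.Product using (Σ; _×_)
open import Relation.Binary.PropositionalEquality using (_≡_; _≢_)
open import Relation.Unary using (Pred; Decidable)
import Data.Bool.Properties as BoolP

-- Every layer V_0 … V_n is represented by Fin w (layers of size < w are
-- padded with unreachable states, which changes neither the computed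
-- function nor which states are of the form v_i(x)).
-- trans i v b = B[v,b] for v ∈ V_i (i < n); accept labels V_n.

record OBP (n w : ℕ) : Set where
  field
    start  : Fin w
    trans  : Fin n → Fin w → Bool → Fin w
    accept : Fin w → Bool

open OBP public

module _ {n w : ℕ} (B : OBP n w) where

  runℕ : Vec Bool n → (i : ℕ) → i ≤ n → Fin w
  runℕ x zero    _ = start B
  runℕ x (suc i) p = trans B (fromℕ< p) (runℕ x i (<⇒≤ p)) (lookup x (fromℕ< p))

  layer : Vec Bool n → Fin (suc n) → Fin w
  layer x j = runℕ x (toℕ j) (toℕ≤pred[n] j)

  eval : Vec Bool n → Bool
  eval x = accept B (runℕ x n ≤-refl)

allVecs : (n : ℕ) → List (Vec Bool n)
allVecs zero    = [] ∷ []
allVecs (suc n) = map (true ∷_) (allVecs n) ++ map (false ∷_) (allVecs n)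

count : {n : ℕ} (P : Pred (Vec Bool n) Level.zero) → Decidable P → ℕ
count {n} P P? = length (filter P? (allVecs n))

prob : {n : ℕ} (P : Pred (Vec Bool n) Level.zero) → Decidable P → ℚ
prob {n} P P? = _/_ (+ count P P?) (2 ^ n) {{m^n≢0 2 n}}

probTrue : {n : ℕ} → (Vec Bool n → Bool) → ℚ
probTrue f = prob (λ x → f x ≡ true) (λ x → f x BoolP.≟ true)

IsHSG : {s n : ℕ} → ℚ → (W : ℕ) → (Vec Bool s → Vec Bool n) → Set
IsHSG {s} {n} ε W H =
  (C : OBP n W) → ε Data.Rational.≤ probTrue (eval C) →
  Σ (Vec Bool s) λ y → eval C (H y) ≡ true

module _ {s n w : ℕ} (B : OBP n w) (H : Vec Bool s → Vec Bool n) where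

  v : Fin (suc n) → Vec Bool s → Fin w
  v j x = layer B (H x) j

  Unverified : Fin n → Fin w → Set
  Unverified i st =
    Σ (Vec Bool s) (λ x → st ≡ v (inject₁ i) x) ×
    Σ Bool (λ b → (x' : Vec Bool s) → trans B i st b ≢ v (Data.Fin.suc i) x')

  -- the path of B on z passes through an unverified state
  -- (states in V_n are always verified, so only layers i < n matter)
  PassesUnverified : Vec Bool n → Set
  PassesUnverified z = Σ (Fin n) λ i → Unverified i (layer B z (inject₁ i))

-- Call an edge of B an escape if it leaves the image of H: it goes from a state by a bit b to a
-- state that is no v_{i+1}(x'). A path through an unverified state is in particular offered an
-- escape. Two facts finish the proof.
--   * Whether an escape is offered at step i depends only on the first i input bits, so the next
--     bit takes the first offered escape with probability 1/2: Pr[T] ≤ 2 Pr[some escape is taken].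
--   * "Some escape is taken" is computed by B plus one absorbing accepting state, a program of
--     width w + 1 ≤ w² (for w = 1 there are no escapes), which rejects every H(y) because the path
--     of H(y) never leaves the image of H. The hitting property of H then forces
--     Pr[some escape is taken] < ε.
module Submission where

open import Level using (0ℓ)
open import Algebra.Properties.CommutativeSemigroup as CommSemigroupProperties using ()
open import Data.Bool as Bool using (Bool; true; false; if_then_else_)
open import Data.Empty using (⊥-elim)
open import Data.Fin as Fin using (Fin; zero; suc; toℕ; fromℕ<; inject₁; _↑ˡ_; _↑ʳ_; splitAt)
open import Data.Fin.Properties
  using (toℕ<n; toℕ-injective; toℕ-fromℕ<; fromℕ<-toℕ; toℕ-inject₁; toℕ≤pred[n]; splitAt-↑ˡ; splitAt-↑ʳ)
open import Data.Integer as ℤ using (ℤ; +_; +≤+)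
open import Data.Integer.Properties using (*-monoʳ-≤-nonNeg; pos-+; pos-*)
open import Data.Integer.Tactic.RingSolver using (solve-∀)
open import Data.List as List using (List; map; filter; length)
open import Data.List.Properties using (filter-++; filter-all; length-++; length-map; length-filter)
open import Data.List.Membership.Propositional using (_∈_)
open import Data.List.Membership.Propositional.Properties using (∈-map⁺; ∈-++⁺ˡ; ∈-++⁺ʳ)
open import Data.List.Relation.Unary.Any using (here)
import Data.List.Relation.Unary.All as All
open import Data.Nat as ℕ using (ℕ; zero; suc; pred; _*_; _^_; _≤_; z≤n; s≤s⁻¹; s<s⁻¹; NonZero)
open import Data.Nat.Properties as ℕ
  using ( ≤-refl; ≤-trans; ≤-reflexive; ≤-irrelevant; <⇒≤; <-≤-trans; m<n⇒m<1+n; m≤n⇒m<n∨m≡n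
        ; m≤m+n; m≤n+m; +-mono-≤; +-identityʳ; +-commutativeSemigroup; suc-pred; m^n≢0)
open import Data.Product using (Σ; _×_; _,_; proj₁)
open import Data.Rational as ℚ using (ℚ; 0ℚ; _<_; _+_; _/_; toℚᵘ)
open import Data.Rational.Properties as ℚ
  using (/-cong; toℚᵘ-cong; toℚᵘ-fromℚᵘ; toℚᵘ-cancel-≤; toℚᵘ-injective; toℚᵘ-homo-+; +-mono-<; ≰⇒>)
open import Data.Rational.Unnormalised as ℚᵘ using (mkℚᵘ; *≤*; *≡*) renaming (_≃_ to _≃ᵘ_)
open import Data.Rational.Unnormalised.Properties as ℚᵘ using (≃-trans; ≃-sym; ≤-respˡ-≃; ≤-respʳ-≃)
open import Data.Sum using (_⊎_; inj₁; inj₂; [_,_]′)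
open import Data.Vec using (Vec; []; _∷_; lookup; replicate)
open import Function using (_∘_; case_of_)
open import Relation.Binary.PropositionalEquality
  using (_≡_; _≢_; refl; sym; cong; cong₂; subst; module ≡-Reasoning) renaming (trans to ≡-trans)
open import Relation.Nullary using (Dec; yes; no; does; ¬_; ¬?)
import Relation.Nullary.Decidable as Dec
open import Relation.Unary using (Pred; Decidable; _⊆_)

open import Defs

open CommSemigroupProperties +-commutativeSemigroup using (interchange)

private variable n : ℕ

∈-allVecs : (x : Vec Bool n) → x ∈ allVecs n
∈-allVecs []          = here refl
∈-allVecs (true ∷ x)  = ∈-++⁺ˡ (∈-map⁺ (true ∷_) (∈-allVecs x))
∈-allVecs (false ∷ x) = ∈-++⁺ʳ _ (∈-map⁺ (false ∷_) (∈-allVecs x))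

length-allVecs : ∀ n → length (allVecs n) ≡ 2 ^ n
length-allVecs zero    = refl
length-allVecs (suc n) = begin
  length (map (true ∷_) xs List.++ map (false ∷_) xs)
    ≡⟨ length-++ (map (true ∷_) xs) ⟩
  length (map (true ∷_) xs) ℕ.+ length (map (false ∷_) xs)
    ≡⟨ cong₂ ℕ._+_ (length-map _ xs) (length-map _ xs) ⟩
  length xs ℕ.+ length xs
    ≡⟨ cong (λ m → m ℕ.+ m) (length-allVecs n) ⟩
  2 ^ n ℕ.+ 2 ^ n
    ≡⟨ cong (2 ^ n ℕ.+_) (sym (+-identityʳ (2 ^ n))) ⟩
  2 ^ suc n ∎
  where
  open ≡-Reasoning
  xs = allVecs n

universal? : {P : Pred (Vec Bool n) 0ℓ} → Decidable P → Dec (∀ x → P x)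
universal? {n} P? = Dec.map′ (λ all x → All.lookup all (∈-allVecs x)) (λ all → All.universal all (allVecs n))
                             (All.all? P? (allVecs n))

filter-map : {A B : Set} {P : Pred B 0ℓ} (P? : Decidable P) (f : A → B) (xs : List A) →
             filter P? (map f xs) ≡ map f (filter (P? ∘ f) xs)
filter-map P? f List.[] = refl
filter-map P? f (x List.∷ xs) with does (P? (f x))
... | true  = cong (f x List.∷_) (filter-map P? f xs)
... | false = filter-map P? f xs

module _ {P : Pred (Vec Bool n) 0ℓ} (P? : Decidable P) where

  count-≤-2^ : count P P? ≤ 2 ^ n
  count-≤-2^ = ≤-trans (length-filter P? (allVecs n)) (≤-reflexive (length-allVecs n))

  count-universal : (∀ x → P x) → count P P? ≡ 2 ^ n
  count-universal all = ≡-trans (cong length (filter-all P? (All.universal all (allVecs n)))) (length-allVecs n)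

count-∷ : {P : Pred (Vec Bool (suc n)) 0ℓ} (P? : Decidable P) →
          count P P? ≡ count (P ∘ (true ∷_)) (P? ∘ (true ∷_))
                       ℕ.+ count (P ∘ (false ∷_)) (P? ∘ (false ∷_))
count-∷ {n} P? = begin
  length (filter P? (map (true ∷_) xs List.++ map (false ∷_) xs))
    ≡⟨ cong length (filter-++ P? (map (true ∷_) xs) _) ⟩
  length (filter P? (map (true ∷_) xs) List.++ filter P? (map (false ∷_) xs))
    ≡⟨ length-++ (filter P? (map (true ∷_) xs)) ⟩
  length (filter P? (map (true ∷_) xs)) ℕ.+ length (filter P? (map (false ∷_) xs))
    ≡⟨ cong₂ ℕ._+_ (length-filter-map true) (length-filter-map false) ⟩
  _ ∎
  where
  open ≡-Reasoning
  xs = allVecs n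
  length-filter-map : ∀ b → length (filter P? (map (b ∷_) xs)) ≡ length (filter (P? ∘ (b ∷_)) xs)
  length-filter-map b = ≡-trans (cong length (filter-map P? (b ∷_) xs))
                                (length-map {A = Vec Bool n} (b ∷_) (filter (P? ∘ (b ∷_)) xs))

count-head≤count : {P : Pred (Vec Bool (suc n)) 0ℓ} (P? : Decidable P) (b : Bool) →
                   count (P ∘ (b ∷_)) (P? ∘ (b ∷_)) ≤ count P P?
count-head≤count P? true  = ≤-trans (m≤m+n _ _) (≤-reflexive (sym (count-∷ P?)))
count-head≤count P? false = ≤-trans (m≤n+m _ _) (≤-reflexive (sym (count-∷ P?)))

count≤twice-count-of-halfspace : {P Q : Pred (Vec Bool (suc n)) 0ℓ} (P? : Decidable P) (Q? : Decidable Q) →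
  (b : Bool) → (∀ z → Q (b ∷ z)) → count P P? ≤ count Q Q? ℕ.+ count Q Q?
count≤twice-count-of-halfspace {n} {P} {Q} P? Q? b half = begin
  count P P?                   ≤⟨ count-≤-2^ P? ⟩
  2 ^ n ℕ.+ (2 ^ n ℕ.+ 0)      ≡⟨ cong (2 ^ n ℕ.+_) (+-identityʳ (2 ^ n)) ⟩
  2 ^ n ℕ.+ 2 ^ n              ≡⟨ cong (λ m → m ℕ.+ m) (sym (count-universal (Q? ∘ (b ∷_)) half)) ⟩
  Qᵇ ℕ.+ Qᵇ                    ≤⟨ +-mono-≤ (count-head≤count Q? b) (count-head≤count Q? b) ⟩
  count Q Q? ℕ.+ count Q Q?    ∎
  where
  open ℕ.≤-Reasoning
  Qᵇ = count (Q ∘ (b ∷_)) (Q? ∘ (b ∷_))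

AgreeBelow : ℕ → Vec Bool n → Vec Bool n → Set
AgreeBelow k z z' = ∀ j → toℕ j ℕ.< k → lookup z j ≡ lookup z' j

-- E i z is the set of bits that are an escape at step i of input z.
Escapes : ℕ → Set₁
Escapes n = Fin n → Vec Bool n → Pred Bool 0ℓ

module _ (E : Escapes n) where

  Offered Taken : Pred (Vec Bool n) 0ℓ
  Offered z = Σ (Fin n) λ i → Σ Bool (E i z)
  Taken   z = Σ (Fin n) λ i → E i z (lookup z i)

  Causal : Set
  Causal = ∀ i {z z'} → AgreeBelow (toℕ i) z z' → E i z ⊆ E i z'

tailEscapes : Escapes (suc n) → Bool → Escapes n
tailEscapes E c i z = E (suc i) (c ∷ z)

tailEscapes-causal : (E : Escapes (suc n)) → Causal E → ∀ c → Causal (tailEscapes E c)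
tailEscapes-causal E causal c i agree = causal (suc i) λ
  { zero    _   → refl
  ; (suc j) j<i → agree j (s<s⁻¹ j<i)
  }

-- Induction on the first bit: if an escape is offered there, it is taken on half of the cube;
-- otherwise both halves are handled by the induction hypothesis.
count-offered≤twice-count-taken : (E : Escapes n) → (∀ i z → Decidable (E i z)) → Causal E →
  {P Q : Pred (Vec Bool n) 0ℓ} (P? : Decidable P) (Q? : Decidable Q) →
  P ⊆ Offered E → Taken E ⊆ Q → count P P? ≤ count Q Q? ℕ.+ count Q Q?
count-offered≤twice-count-taken {zero} E E? causal P? Q? P⊆O T⊆Q with P? []
... | yes p with () ← proj₁ (P⊆O p)
... | no _  = z≤n
count-offered≤twice-count-taken {suc n} E E? causal {P} {Q} P? Q? P⊆O T⊆Q
  with E? zero (replicate (suc n) false) true | E? zero (replicate (suc n) false) false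
... | yes e | _     = count≤twice-count-of-halfspace P? Q? true  λ _ → T⊆Q (zero , causal zero (λ _ ()) e)
... | no _  | yes e = count≤twice-count-of-halfspace P? Q? false λ _ → T⊆Q (zero , causal zero (λ _ ()) e)
... | no ¬t | no ¬f = begin
  count P P?                                              ≡⟨ count-∷ P? ⟩
  countP true ℕ.+ countP false                            ≤⟨ +-mono-≤ (halves true) (halves false) ⟩
  (countQ true ℕ.+ countQ true) ℕ.+ (countQ false ℕ.+ countQ false)
                                                          ≡⟨ interchange (countQ true) _ _ _ ⟩
  (countQ true ℕ.+ countQ false) ℕ.+ (countQ true ℕ.+ countQ false)
                                                          ≡⟨ cong (λ m → m ℕ.+ m) (sym (count-∷ Q?)) ⟩
  count Q Q? ℕ.+ count Q Q?                               ∎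
  where
  open ℕ.≤-Reasoning
  countP countQ : Bool → ℕ
  countP c = count (P ∘ (c ∷_)) (P? ∘ (c ∷_))
  countQ c = count (Q ∘ (c ∷_)) (Q? ∘ (c ∷_))
  noRootEscape : ∀ z b → ¬ E zero z b
  noRootEscape z true  e = ¬t (causal zero (λ _ ()) e)
  noRootEscape z false e = ¬f (causal zero (λ _ ()) e)
  halves : ∀ c → countP c ≤ countQ c ℕ.+ countQ c
  halves c = count-offered≤twice-count-taken (tailEscapes E c) (λ i z → E? (suc i) (c ∷ z))
    (tailEscapes-causal E causal c) (P? ∘ (c ∷_)) (Q? ∘ (c ∷_))
    (λ p → case P⊆O p of λ
      { (zero  , b , e) → ⊥-elim (noRootEscape _ b e)
      ; (suc i , b , e) → i , b , e
      })
    (λ (i , e) → T⊆Q (suc i , e))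

Accepts : {w : ℕ} → OBP n w → Pred (Vec Bool n) 0ℓ
Accepts C z = eval C z ≡ true

module _ {n w : ℕ} (B : OBP n w) where

  runℕ-irrelevant : ∀ z {i j} → i ≡ j → (p : i ≤ n) (q : j ≤ n) → runℕ B z i p ≡ runℕ B z j q
  runℕ-irrelevant z refl p q = cong (runℕ B z _) (≤-irrelevant p q)

  runℕ-agreeBelow : ∀ {z z'} k (p : k ≤ n) → AgreeBelow k z z' → runℕ B z k p ≡ runℕ B z' k p
  runℕ-agreeBelow zero    p agree = refl
  runℕ-agreeBelow (suc k) p agree =
    cong₂ (trans B (fromℕ< p)) (runℕ-agreeBelow k (<⇒≤ p) λ j j<k → agree j (m<n⇒m<1+n j<k))
                               (agree (fromℕ< p) (≤-reflexive (cong suc (toℕ-fromℕ< p))))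

  layer-inject₁-fromℕ< : ∀ z {k} (p : suc k ≤ n) → layer B z (inject₁ (fromℕ< p)) ≡ runℕ B z k (<⇒≤ p)
  layer-inject₁-fromℕ< z p = runℕ-irrelevant z (≡-trans (toℕ-inject₁ (fromℕ< p)) (toℕ-fromℕ< p)) _ _

  layer-suc : ∀ z i → layer B z (suc i) ≡ trans B i (layer B z (inject₁ i)) (lookup z i)
  layer-suc z i = begin
    trans B j (runℕ B z (toℕ i) (<⇒≤ p)) (lookup z j)
      ≡⟨ cong (λ q → trans B j q (lookup z j)) (sym (layer-inject₁-fromℕ< z p)) ⟩
    step j
      ≡⟨ cong step (fromℕ<-toℕ i p) ⟩
    step i
      ∎
    where
    open ≡-Reasoning
    p = toℕ≤pred[n] (suc i)
    j = fromℕ< p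
    step : Fin n → Fin w
    step k = trans B k (layer B z (inject₁ k)) (lookup z k)

  EdgeSet : Set₁
  EdgeSet = Fin n → Fin w → Pred Bool 0ℓ

  alongPath : EdgeSet → Escapes n
  alongPath M i z = M i (layer B z (inject₁ i))

  alongPath-causal : (M : EdgeSet) → Causal (alongPath M)
  alongPath-causal M i agree =
    subst (λ q → M i q _)
          (runℕ-agreeBelow _ _ λ j j<i → agree j (<-≤-trans j<i (≤-reflexive (toℕ-inject₁ i))))

  module _ (M : EdgeSet) (M? : ∀ i q → Decidable (M i q)) where

    -- zero is an absorbing accepting sink, entered on the first marked edge; suc q follows B in state q.
    detectorStep : Fin n → Fin (suc w) → Bool → Fin (suc w)
    detectorStep i zero    b = zero
    detectorStep i (suc q) b = if does (M? i q b) then zero else suc (trans B i q b)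

    detector : OBP n (suc w)
    detector = record
      { start  = suc (start B)
      ; trans  = detectorStep
      ; accept = λ { zero → true ; (suc _) → false }
      }

    MarkedBefore : ℕ → Pred (Vec Bool n) 0ℓ
    MarkedBefore k z = Σ (Fin n) λ i → toℕ i ℕ.< k × alongPath M i z (lookup z i)

    DetectorInvariant : ∀ z k → k ≤ n → Fin (suc w) → Set
    DetectorInvariant z k p st =
      (st ≡ zero × MarkedBefore k z) ⊎ (st ≡ suc (runℕ B z k p) × ¬ MarkedBefore k z)

    detectorStep-invariant : ∀ z k (p : suc k ≤ n) st → DetectorInvariant z k (<⇒≤ p) st →
      DetectorInvariant z (suc k) p (detectorStep (fromℕ< p) st (lookup z (fromℕ< p)))
    detectorStep-invariant z k p .zero (inj₁ (refl , (i , i<k , m))) = inj₁ (refl , (i , m<n⇒m<1+n i<k , m))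
    detectorStep-invariant z k p .(suc _) (inj₂ (refl , unmarked)) with M? j q (lookup z j)
      where j = fromℕ< p
            q = runℕ B z k (<⇒≤ p)
    ... | yes m = inj₁ (refl , (fromℕ< p , ≤-reflexive (cong suc (toℕ-fromℕ< p)) , atLayer m))
      where atLayer = subst (λ q → M (fromℕ< p) q (lookup z (fromℕ< p))) (sym (layer-inject₁-fromℕ< z p))
    ... | no ¬m = inj₂ (refl , λ (i , i<1+k , mi) →
      [ (λ i<k → unmarked (i , i<k , mi)) , (λ i≡k → ¬m (markedAtStep i i≡k mi)) ]′
        (m≤n⇒m<n∨m≡n (s≤s⁻¹ i<1+k)))
      where
      markedAtStep : ∀ i → toℕ i ≡ k → alongPath M i z (lookup z i) →
                     M (fromℕ< p) (runℕ B z k (<⇒≤ p)) (lookup z (fromℕ< p))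
      markedAtStep i i≡k mi with toℕ-injective {i = i} {j = fromℕ< p} (≡-trans i≡k (sym (toℕ-fromℕ< p)))
      ... | refl = subst (λ q → M (fromℕ< p) q _) (layer-inject₁-fromℕ< z p) mi

    detector-run : ∀ z k (p : k ≤ n) → DetectorInvariant z k p (runℕ detector z k p)
    detector-run z zero    p = inj₂ (refl , λ ())
    detector-run z (suc k) p = detectorStep-invariant z k p _ (detector-run z k (<⇒≤ p))

    taken⊆detector-accepts : Taken (alongPath M) ⊆ Accepts detector
    taken⊆detector-accepts {z} (i , m) with detector-run z n ≤-refl
    ... | inj₁ (sunk , _)     = cong (accept detector) sunk
    ... | inj₂ (_ , unmarked) = ⊥-elim (unmarked (i , toℕ<n i , m))

    detector-accepts⊆taken : Accepts detector ⊆ Taken (alongPath M)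
    detector-accepts⊆taken {z} acc with detector-run z n ≤-refl
    ... | inj₁ (_ , (i , _ , m)) = i , m
    ... | inj₂ (tracking , _) with () ← ≡-trans (sym (cong (accept detector) tracking)) acc

module _ {m m' : ℕ} (e : Fin m → Fin m') (d : Fin m' → Fin m) (d∘e : ∀ q → d (e q) ≡ q) where

  relabel : OBP n m → OBP n m'
  relabel C = record
    { start  = e (start C)
    ; trans  = λ i q b → e (trans C i (d q) b)
    ; accept = accept C ∘ d
    }

  runℕ-relabel : (C : OBP n m) (z : Vec Bool n) (k : ℕ) (p : k ≤ n) →
                 runℕ (relabel C) z k p ≡ e (runℕ C z k p)
  runℕ-relabel C z zero    p = refl
  runℕ-relabel C z (suc k) p rewrite runℕ-relabel C z k (<⇒≤ p) | d∘e (runℕ C z k (<⇒≤ p)) = refl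

  eval-relabel : (C : OBP n m) (z : Vec Bool n) → eval (relabel C) z ≡ eval C z
  eval-relabel C z = ≡-trans (cong (accept C ∘ d) (runℕ-relabel C z _ ≤-refl)) (cong (accept C) (d∘e _))

module _ {w r : ℕ} where

  pad : Fin (suc w) → Fin (w ℕ.+ suc r)
  pad zero    = w ↑ʳ zero
  pad (suc q) = q ↑ˡ suc r

  unpad : Fin (w ℕ.+ suc r) → Fin (suc w)
  unpad q = [ suc , (λ _ → zero) ]′ (splitAt w q)

  unpad∘pad : ∀ q → unpad (pad q) ≡ q
  unpad∘pad zero    = cong [ suc , (λ _ → zero) ]′ (splitAt-↑ʳ w (suc r) zero)
  unpad∘pad (suc q) = cong [ suc , (λ _ → zero) ]′ (splitAt-↑ˡ w q (suc r))

module _ {s n w : ℕ} (B : OBP n w) (H : Vec Bool s → Vec Bool n) where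

  LeavesImage : EdgeSet B
  LeavesImage i q b = ∀ x' → trans B i q b ≢ v B H (suc i) x'

  leavesImage? : ∀ i q → Decidable (LeavesImage i q)
  leavesImage? i q b = universal? (λ x' → ¬? (trans B i q b Fin.≟ v B H (suc i) x'))

  passesUnverified⊆offered : PassesUnverified B H ⊆ Offered (alongPath B LeavesImage)
  passesUnverified⊆offered (i , _ , escape) = i , escape

  H-takes-no-escape : ∀ y → ¬ Taken (alongPath B LeavesImage) (H y)
  H-takes-no-escape y (i , leaves) = leaves y (sym (layer-suc B (H y) i))

escapeDetector : {s n w : ℕ} (B : OBP n w) (H : Vec Bool s → Vec Bool n) →
  Σ (OBP n (w * w)) λ C → Taken (alongPath B (LeavesImage B H)) ⊆ Accepts C
                        × Accepts C ⊆ Taken (alongPath B (LeavesImage B H))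
escapeDetector {w = zero} B H with () ← start B
escapeDetector {s} {w = suc zero} B H =
  rejectAll , (λ (i , leaves) → ⊥-elim (leaves (replicate s false) (Fin1-≡ _ _))) , λ ()
  where
  rejectAll : OBP _ 1
  rejectAll = record { start = zero ; trans = λ _ _ _ → zero ; accept = λ _ → false }
  Fin1-≡ : (a b : Fin 1) → a ≡ b
  Fin1-≡ zero zero = refl
-- for w = 2 + k, w * w reduces to w + suc (k + k * w), so the w + 1 detector states fit
escapeDetector {w = suc (suc k)} B H =
  relabel pad unpad unpad∘pad D ,
  (λ taken → ≡-trans (eval-relabel pad unpad unpad∘pad D _) (taken⊆detector-accepts B M M? taken)) ,
  (λ acc → detector-accepts⊆taken B M M? (≡-trans (sym (eval-relabel pad unpad unpad∘pad D _)) acc))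
  where
  M  = LeavesImage B H
  M? = leavesImage? B H
  D  = detector B M M?

module _ (N : ℕ) .{{_ : NonZero N}} where

  private
    toℚᵘ-/ : ∀ a → toℚᵘ (+ a / N) ≃ᵘ mkℚᵘ (+ a) (pred N)
    toℚᵘ-/ a = ≃-trans (toℚᵘ-cong (/-cong {+ a} refl (sym (suc-pred N))))
                       (toℚᵘ-fromℚᵘ (mkℚᵘ (+ a) (pred N)))

  /-monoˡ-≤ : ∀ {a b} → a ≤ b → + a / N ℚ.≤ + b / N
  /-monoˡ-≤ {a} {b} a≤b = toℚᵘ-cancel-≤
    (≤-respˡ-≃ (≃-sym (toℚᵘ-/ a)) (≤-respʳ-≃ (≃-sym (toℚᵘ-/ b))
      (*≤* (*-monoʳ-≤-nonNeg (+ suc (pred N)) (+≤+ a≤b)))))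

  /-distribʳ-+ : ∀ a b → + (a ℕ.+ b) / N ≡ + a / N + + b / N
  /-distribʳ-+ a b = toℚᵘ-injective (≃-trans (toℚᵘ-/ (a ℕ.+ b)) (≃-trans commonDenominator
    (≃-sym (≃-trans (toℚᵘ-homo-+ (+ a / N) (+ b / N)) (ℚᵘ.+-cong (toℚᵘ-/ a) (toℚᵘ-/ b))))))
    where
    commonDenominator : mkℚᵘ (+ (a ℕ.+ b)) (pred N) ≃ᵘ mkℚᵘ (+ a) (pred N) ℚᵘ.+ mkℚᵘ (+ b) (pred N)
    commonDenominator = *≡* (≡-trans (cong₂ ℤ._*_ (pos-+ a b) (pos-* (suc (pred N)) (suc (pred N))))
                                     (ring (+ a) (+ b) (+ suc (pred N))))
      where
      ring : ∀ (x y d : ℤ) → (x ℤ.+ y) ℤ.* (d ℤ.* d) ≡ (x ℤ.* d ℤ.+ y ℤ.* d) ℤ.* d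
      ring = solve-∀

lemma6p13 : {s n w : ℕ} (ε : ℚ) → 0ℚ < ε →
    (H : Vec Bool s → Vec Bool n) → IsHSG ε (w * w) H →
    (B : OBP n w) → (T? : Decidable (PassesUnverified B H)) →
    prob (PassesUnverified B H) T? < ε + ε
lemma6p13 {n = n} ε _ H hsg B T? with escapeDetector B H
... | C , taken⊆accepts , accepts⊆taken = begin-strict
  prob (PassesUnverified B H) T?                   ≤⟨ /-monoˡ-≤ (2 ^ n) unverified≤twice-accepted ⟩
  + (#accepted ℕ.+ #accepted) / 2 ^ n              ≡⟨ /-distribʳ-+ (2 ^ n) #accepted #accepted ⟩
  probTrue (eval C) + probTrue (eval C)            <⟨ +-mono-< C-rarely-accepts C-rarely-accepts ⟩
  ε + ε                                            ∎
  where
  open ℚ.≤-Reasoning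
  instance _ = m^n≢0 2 n
  accepts? : Decidable (Accepts C)
  accepts? z = eval C z Bool.≟ true
  #accepted = count (Accepts C) accepts?
  unverified≤twice-accepted : count (PassesUnverified B H) T? ≤ #accepted ℕ.+ #accepted
  unverified≤twice-accepted = count-offered≤twice-count-taken (alongPath B (LeavesImage B H))
    (λ i z → leavesImage? B H i (layer B z (inject₁ i))) (alongPath-causal B (LeavesImage B H))
    T? accepts? (passesUnverified⊆offered B H) taken⊆accepts
  C-rarely-accepts : probTrue (eval C) < ε
  C-rarely-accepts = ≰⇒> λ ε≤ →
    let (y , accepted) = hsg C ε≤ in H-takes-no-escape B H y (accepts⊆taken accepted)
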